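{- Let $k\ge 1$ and $n_1,\ldots,n_k\ge 1$ be integers, and let $G=P_{n_1}\Box P_{n_2}\Box\cdots\Box P_{n_k}$ be the $k$-dimensional grid with dimensions $n_1,\ldots,n_k$ (where $P_m$ is the path on $m$ vertices). Then $G$ has outcome $\mathcal{N}$ for \textsc{Closed Geodetic Game} if and only if all of $n_1,\ldots,n_k$ are odd.
   Context: The Cartesian product $G\,\Box\, H$ has vertex set $V(G)\times V(H)$, with $(u_1,v_1)$ adjacent to $(u_2,v_2)$ iff either $u_1=u_2$ and $v_1v_2\in E(H)$, or $v_1=v_2$ and $u_1u_2\in E(G)$. For vertices $x,y$, $\mathcal{I}(x,y)$ is the set of vertices on some shortest $x$–$y$ path ($\mathcal{I}(x,x)=\{x\}$); for a vertex set $S$, the geodetic closure is $(S)=\bigcup_{x,y\in S}\mathcal{I}(x,y)$. \textsc{Closed Geodetic Game}: starting from $S=\emptyset$, two players alternately add to $S$ a vertex not in the current closure $(S)$; the game ends when $(S)$ is the whole vertex set, and the player who made the last move wins. Outcome $\mathcal{N}$ means the first player has a winning strategy. -}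

module Defs where

open import Data.Nat using (ℕ; zero; suc; _≤_; _%_)
open import Data.Fin using (Fin; toℕ)
open import Data.Vec using (Vec; []; _∷_)
open import Data.List using (List; []; _∷_)
open import Data.List.Membership.Propositional using (_∈_)
open import Data.Product using (Σ; ∃; _×_; _,_)
open import Data.Sum using (_⊎_)
open import Relation.Binary.PropositionalEquality using (_≡_)
open import Relation.Nullary using (¬_)

record Graph : Set₁ where
  field
    V   : Set
    Adj : V → V → Set
open Graph public

Path : ℕ → Graph
Path m = record { V = Fin m
                ; Adj = λ i j → (toℕ j ≡ suc (toℕ i)) ⊎ (toℕ i ≡ suc (toℕ j)) }

_□_ : Graph → Graph → Graph
G □ H = record
  { V = V G × V H
  ; Adj = λ { (u₁ , v₁) (u₂ , v₂) →
              (u₁ ≡ u₂ × Adj H v₁ v₂) ⊎ (v₁ ≡ v₂ × Adj G u₁ u₂) } }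

-- k-dimensional grid P_{n₁} □ (P_{n₂} □ ( … □ P_{nₖ})), k = suc j ≥ 1.
Grid : ∀ {j} → Vec ℕ (suc j) → Graph
Grid {zero}  (m ∷ [])     = Path m
Grid {suc j} (m ∷ ms)     = Path m □ Grid ms

module _ (G : Graph) where

  data Walk : V G → V G → ℕ → Set where
    here : ∀ {x} → Walk x x 0
    step : ∀ {x y z l} → Adj G x y → Walk y z l → Walk x z (suc l)

  data OnWalk (z : V G) : ∀ {x y l} → Walk x y l → Set where
    on-here : OnWalk z (here {z})
    on-head : ∀ {y w l} {e : Adj G z y} {p : Walk y w l} → OnWalk z (step e p)
    on-tail : ∀ {x y w l} {e : Adj G x y} {p : Walk y w l} → OnWalk z p → OnWalk z (step e p)

  Shortest : ∀ {x y l} → Walk x y l → Set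
  Shortest {x} {y} {l} _ = ∀ l' → Walk x y l' → l ≤ l'

  Interval : V G → V G → V G → Set
  Interval x y z = Σ ℕ λ l → Σ (Walk x y l) λ w → Shortest w × OnWalk z w

  InClosure : List (V G) → V G → Set
  InClosure S z = Σ (V G) λ x → Σ (V G) λ y → x ∈ S × y ∈ S × Interval x y z

  -- Closed Geodetic Game, normal play.
  -- MoverWins S : the player to move at position S has a winning strategy;
  -- MoverLoses S : every legal move leads to a position winning for the
  -- opponent (in particular, if (S) = V no move exists and the mover loses,
  -- since the opponent made the last move).
  data MoverWins (S : List (V G)) : Set
  data MoverLoses (S : List (V G)) : Set

  data MoverWins S where
    move : (v : V G) → ¬ InClosure S v → MoverLoses (v ∷ S) → MoverWins S

  data MoverLoses S where
    allMoves : ((v : V G) → ¬ InClosure S v → MoverWins (v ∷ S)) → MoverLoses S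

  OutcomeN : Set
  OutcomeN = MoverWins []

Odd : ℕ → Set
Odd n = n % 2 ≡ 1

{-# OPTIONS --safe #-}
-- Mirror strategy. Reflecting every coordinate, i ↦ nᵢ - 1 - i, is an isometric
-- involution σ of the grid with one more property: if σ v lies on a geodesic from
-- v to s, then v lies on a geodesic from s to σ s. Consequently, when the chosen set
-- S is closed under σ and contains every fixed point of σ, each legal move v can be
-- answered by σ v, since σ v ∈ (S ∪ {v}) would already force v ∈ (S); the answer
-- restores the invariant, so the player who mirrors makes the last move. If some nᵢ
-- is even, σ has no fixed point and the second player mirrors from the start; if
-- all nᵢ are odd, the centre is the unique fixed point, and the first player takes
-- it and mirrors from then on.
module Submission where

open import Defs
open import Data.Fin using (Fin; toℕ; fromℕ<; opposite)
  renaming (zero to fzero; suc to fsuc)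
open import Data.Fin.Properties
  using (toℕ-injective; toℕ-fromℕ<; toℕ<n; opposite-prop; opposite-involutive; *↔×; injective⇒≤)
open import Data.List using (List; []; _∷_; length; lookup)
open import Data.List.Membership.Propositional using (_∈_)
open import Data.List.Membership.Propositional.Properties using (∈-lookup)
import Data.List.Relation.Unary.All as All
open import Data.List.Relation.Unary.All.Properties.Core using (¬Any⇒All¬)
open import Data.List.Relation.Unary.AllPairs using ([]; _∷_)
open import Data.List.Relation.Unary.Any using (here; there)
open import Data.List.Relation.Unary.Unique.Propositional using (Unique)
open import Data.Nat using (ℕ; zero; suc; _≤_; _<_; _+_; _*_; ∣_-_∣; z≤n; s≤s; _%_; _/_; _≟_)
open import Data.Nat.DivMod using (m≡m%n+[m/n]*n; [m+kn]%n≡m%n)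
open import Data.Nat.Properties
open import Algebra.Properties.CommutativeSemigroup +-commutativeSemigroup using (interchange)
open import Data.Product using (∃; ∃₂; _×_; _,_; proj₁; proj₂)
open import Data.Product.Function.NonDependent.Propositional using (_×-↣_)
open import Data.Sum using (_⊎_; inj₁; inj₂)
open import Data.Vec using (Vec; []; _∷_)
open import Data.Vec.Relation.Unary.All using (All; []; _∷_; all?)
open import Function using (_∘_)
open import Function.Bundles using (_⇔_; mk⇔; _↣_; Injection)
open import Function.Construct.Composition using (_↣-∘_)
open import Function.Construct.Identity using (↣-id)
open import Function.Construct.Symmetry using (↔-sym)
open import Function.Properties.Inverse using (↔⇒↣)
open import Relation.Binary.PropositionalEquality
open import Relation.Nullary using (¬_; contradiction)
open import Relation.Nullary.Decidable using (decidable-stable)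

module _ {G : Graph} where

  _++ʷ_ : ∀ {x y z a b} → Walk G x y a → Walk G y z b → Walk G x z (a + b)
  here     ++ʷ q = q
  step e p ++ʷ q = step e (p ++ʷ q)

  onWalk-++ʷ : ∀ {x y z a b} (p : Walk G x y a) (q : Walk G y z b) → OnWalk G y (p ++ʷ q)
  onWalk-++ʷ here       here       = on-here
  onWalk-++ʷ here       (step e q) = on-head
  onWalk-++ʷ (step e p) q          = on-tail (onWalk-++ʷ p q)

  onWalk-split : ∀ {x y z l} {w : Walk G x y l} → OnWalk G z w →
              ∃₂ λ a b → Walk G x z a × Walk G z y b × a + b ≡ l
  onWalk-split {w = here}     on-here     = 0 , 0 , here , here , refl
  onWalk-split {w = step e p} on-head     = 0 , _ , here , step e p , refl
  onWalk-split {w = step e p} (on-tail o) with onWalk-split o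
  ... | a , b , p₁ , p₂ , a+b≡l = suc a , b , step e p₁ , p₂ , cong suc a+b≡l

  interval-refl : ∀ {x} → Interval G x x x
  interval-refl = 0 , here , (λ _ _ → z≤n) , on-here

  interval-self : ∀ {x z} → Interval G x x z → z ≡ x
  interval-self (_ , _ , shortest , _) with n≤0⇒n≡0 (shortest 0 here)
  interval-self (_ , here , _ , on-here) | refl = refl

record Distance (G : Graph) : Set where
  field
    d        : V G → V G → ℕ
    geodesic : ∀ x y → Walk G x y (d x y)
    d≤length : ∀ {x y l} → Walk G x y l → d x y ≤ l
    d-sym    : ∀ x y → d x y ≡ d y x

module _ {G : Graph} (D : Distance G) where
  open Distance D

  Between : V G → V G → V G → Set
  Between x z y = d x z + d z y ≡ d x y

  triangle : ∀ x z y → d x y ≤ d x z + d z y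
  triangle x z y = d≤length (geodesic x z ++ʷ geodesic z y)

  interval⇒between : ∀ {x y z} → Interval G x y z → Between x z y
  interval⇒between {x} {y} {z} (l , w , shortest , z∈w) with onWalk-split z∈w
  ... | a , b , p , q , a+b≡l = ≤-antisym (begin
    d x z + d z y ≤⟨ +-mono-≤ (d≤length p) (d≤length q) ⟩
    a + b         ≡⟨ a+b≡l ⟩
    l             ≤⟨ shortest _ (geodesic x y) ⟩
    d x y         ∎) (triangle x z y)
    where open ≤-Reasoning

  between⇒interval : ∀ {x y z} → Between x z y → Interval G x y z
  between⇒interval {x} {y} {z} x-z-y =
    _ , geodesic x z ++ʷ geodesic z y ,
    (λ l w → subst (_≤ l) (sym x-z-y) (d≤length w)) ,
    onWalk-++ʷ (geodesic x z) (geodesic z y)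

  between-sym : ∀ {x z y} → Between x z y → Between y z x
  between-sym {x} {z} {y} x-z-y = begin
    d y z + d z x ≡⟨ cong₂ _+_ (d-sym y z) (d-sym z x) ⟩
    d z y + d x z ≡⟨ +-comm (d z y) (d x z) ⟩
    d x z + d z y ≡⟨ x-z-y ⟩
    d x y         ≡⟨ d-sym x y ⟩
    d y x         ∎
    where open ≡-Reasoning

record Mirror {G : Graph} (D : Distance G) : Set where
  field
    σ            : V G → V G
    σ-involutive : ∀ x → σ (σ x) ≡ x
    σ-isometry   : ∀ x y → Distance.d D (σ x) (σ y) ≡ Distance.d D x y
    σ-beyond     : ∀ {v s} → Between D v (σ v) s → Between D s v (σ s)

  σ-between : ∀ {x z y} → Between D x z y → Between D (σ x) (σ z) (σ y)
  σ-between {x} {z} {y} x-z-y =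
    trans (cong₂ _+_ (σ-isometry x z) (σ-isometry z y)) (trans x-z-y (sym (σ-isometry x y)))

module _ {G H : Graph} where

  liftˡ : ∀ {u₁ u₂ l} v → Walk G u₁ u₂ l → Walk (G □ H) (u₁ , v) (u₂ , v) l
  liftˡ v here       = here
  liftˡ v (step e p) = step (inj₂ (refl , e)) (liftˡ v p)

  liftʳ : ∀ {v₁ v₂ l} u → Walk H v₁ v₂ l → Walk (G □ H) (u , v₁) (u , v₂) l
  liftʳ u here       = here
  liftʳ u (step e p) = step (inj₁ (refl , e)) (liftʳ u p)

  _×ᴰ_ : Distance G → Distance H → Distance (G □ H)
  D ×ᴰ E = record { d = d ; geodesic = geodesic ; d≤length = d≤length ; d-sym = d-sym }
    where
    module D = Distance D
    module E = Distance E

    d : V (G □ H) → V (G □ H) → ℕ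
    d x y = D.d (proj₁ x) (proj₁ y) + E.d (proj₂ x) (proj₂ y)

    geodesic : ∀ x y → Walk (G □ H) x y (d x y)
    geodesic (x₁ , x₂) (y₁ , y₂) = liftˡ x₂ (D.geodesic x₁ y₁) ++ʷ liftʳ y₁ (E.geodesic x₂ y₂)

    d≤length : ∀ {x y l} → Walk (G □ H) x y l → d x y ≤ l
    d≤length {x₁ , x₂} here =
      ≤-reflexive (cong₂ _+_ (n≤0⇒n≡0 (D.d≤length here)) (n≤0⇒n≡0 (E.d≤length here)))
    d≤length {x₁ , x₂} {z₁ , z₂} {suc l} (step {y = _ , y₂} (inj₁ (refl , e)) w) = begin
      D.d x₁ z₁ + E.d x₂ z₂       ≤⟨ +-monoʳ-≤ (D.d x₁ z₁) (E.d≤length (step e (E.geodesic y₂ z₂))) ⟩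
      D.d x₁ z₁ + suc (E.d y₂ z₂) ≡⟨ +-suc (D.d x₁ z₁) (E.d y₂ z₂) ⟩
      suc (d (x₁ , y₂) (z₁ , z₂)) ≤⟨ s≤s (d≤length w) ⟩
      suc l                       ∎
      where open ≤-Reasoning
    d≤length {x₁ , x₂} {z₁ , z₂} {suc l} (step {y = y₁ , _} (inj₂ (refl , e)) w) = begin
      D.d x₁ z₁ + E.d x₂ z₂       ≤⟨ +-monoˡ-≤ (E.d x₂ z₂) (D.d≤length (step e (D.geodesic y₁ z₁))) ⟩
      suc (d (y₁ , x₂) (z₁ , z₂)) ≤⟨ s≤s (d≤length w) ⟩
      suc l                       ∎
      where open ≤-Reasoning

    d-sym : ∀ x y → d x y ≡ d y x
    d-sym (x₁ , x₂) (y₁ , y₂) = cong₂ _+_ (D.d-sym x₁ y₁) (E.d-sym x₂ y₂)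

bounds-tight : ∀ {a b f g} → f ≤ a → g ≤ b → a + b ≡ f + g → a ≡ f × b ≡ g
bounds-tight {a} {b} {f} {g} f≤a g≤b a+b≡f+g =
  ≤-antisym (+-cancelʳ-≤ b a f (≤-trans (≤-reflexive a+b≡f+g) (+-monoʳ-≤ f g≤b))) f≤a ,
  ≤-antisym (+-cancelˡ-≤ a b g (≤-trans (≤-reflexive a+b≡f+g) (+-monoˡ-≤ g f≤a))) g≤b

module _ {G H : Graph} (D : Distance G) (E : Distance H) where
  private
    module D = Distance D
    module E = Distance E

  between-×⁻ : ∀ {x z y} → Between (D ×ᴰ E) x z y →
               Between D (proj₁ x) (proj₁ z) (proj₁ y) × Between E (proj₂ x) (proj₂ z) (proj₂ y)
  between-×⁻ {x₁ , x₂} {z₁ , z₂} {y₁ , y₂} x-z-y =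
    bounds-tight (triangle D x₁ z₁ y₁) (triangle E x₂ z₂ y₂)
      (trans (interchange (D.d x₁ z₁) (D.d z₁ y₁) (E.d x₂ z₂) (E.d z₂ y₂)) x-z-y)

  between-×⁺ : ∀ {x z y} →
               Between D (proj₁ x) (proj₁ z) (proj₁ y) → Between E (proj₂ x) (proj₂ z) (proj₂ y) →
               Between (D ×ᴰ E) x z y
  between-×⁺ {x₁ , x₂} {z₁ , z₂} {y₁ , y₂} x-z-y₁ x-z-y₂ =
    trans (interchange (D.d x₁ z₁) (E.d x₂ z₂) (D.d z₁ y₁) (E.d z₂ y₂)) (cong₂ _+_ x-z-y₁ x-z-y₂)

module _ {G H : Graph} {D : Distance G} {E : Distance H} where

  _×ᴹ_ : Mirror D → Mirror E → Mirror (D ×ᴰ E)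
  S ×ᴹ T = record
    { σ            = λ (u , v) → S.σ u , T.σ v
    ; σ-involutive = λ (u , v) → cong₂ _,_ (S.σ-involutive u) (T.σ-involutive v)
    ; σ-isometry   = λ (x₁ , x₂) (y₁ , y₂) → cong₂ _+_ (S.σ-isometry x₁ y₁) (T.σ-isometry x₂ y₂)
    ; σ-beyond     = λ {v} {s} v-σv-s → let (b₁ , b₂) = between-×⁻ D E {v} {_} {s} v-σv-s in
                       between-×⁺ D E {s} {v} (S.σ-beyond b₁) (T.σ-beyond b₂)
    }
    where
    module S = Mirror S
    module T = Mirror T

module _ {A : Set} where

  Unique-lookup-injective : ∀ {xs : List A} → Unique xs → ∀ {i j} → lookup xs i ≡ lookup xs j → i ≡ j
  Unique-lookup-injective (_ ∷ _)    {fzero}  {fzero}  _ = refl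
  Unique-lookup-injective (x≢xs ∷ _) {fzero}  {fsuc j} x≡xsⱼ =
    contradiction x≡xsⱼ (All.lookup x≢xs (∈-lookup j))
  Unique-lookup-injective (x≢xs ∷ _) {fsuc i} {fzero}  xsᵢ≡x =
    contradiction (sym xsᵢ≡x) (All.lookup x≢xs (∈-lookup i))
  Unique-lookup-injective (_ ∷ u)    {fsuc i} {fsuc j} xsᵢ≡xsⱼ =
    cong fsuc (Unique-lookup-injective u xsᵢ≡xsⱼ)

  Unique⇒length≤ : ∀ {N} → A ↣ Fin N → ∀ {xs} → Unique xs → length xs ≤ N
  Unique⇒length≤ ι u = injective⇒≤ (Unique-lookup-injective u ∘ Injection.injective ι)

wins⇒¬loses : ∀ {G S} → MoverWins G S → ¬ MoverLoses G S
wins⇒¬loses (move v v∉S loses) (allMoves wins) = wins⇒¬loses (wins v v∉S) loses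

module MirrorStrategy {G : Graph} {D : Distance G} (S : Mirror D) {N : ℕ} (ι : V G ↣ Fin N) where
  open Mirror S

  MirrorClosed : List (V G) → Set
  MirrorClosed xs = ∀ {x} → x ∈ xs → σ x ∈ xs

  ContainsFixedPoints : List (V G) → Set
  ContainsFixedPoints xs = ∀ x → σ x ≡ x → x ∈ xs

  ∈⇒inClosure : ∀ {xs x} → x ∈ xs → InClosure G xs x
  ∈⇒inClosure x∈xs = _ , _ , x∈xs , x∈xs , interval-refl

  inClosure-mirror : ∀ {xs z} → MirrorClosed xs → InClosure G xs z → InClosure G xs (σ z)
  inClosure-mirror closed (x , y , x∈xs , y∈xs , x-z-y) =
    σ x , σ y , closed x∈xs , closed y∈xs , between⇒interval D (σ-between (interval⇒between D x-z-y))

  mirror-reply-legal : ∀ {xs v} → MirrorClosed xs → ContainsFixedPoints xs →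
                       ¬ InClosure G xs v → ¬ InClosure G (v ∷ xs) (σ v)
  mirror-reply-legal {v = v} closed fixed v∉ (_ , _ , here refl , here refl , v-σv-v) =
    v∉ (∈⇒inClosure (fixed v (interval-self v-σv-v)))
  mirror-reply-legal closed fixed v∉ (_ , y , here refl , there y∈xs , v-σv-y) =
    v∉ (y , σ y , y∈xs , closed y∈xs , between⇒interval D (σ-beyond (interval⇒between D v-σv-y)))
  mirror-reply-legal closed fixed v∉ (x , _ , there x∈xs , here refl , x-σv-v) =
    v∉ (x , σ x , x∈xs , closed x∈xs ,
        between⇒interval D (σ-beyond (between-sym D (interval⇒between D x-σv-v))))
  mirror-reply-legal {xs} {v} closed fixed v∉ (x , y , there x∈xs , there y∈xs , x-σv-y) =
    v∉ (subst (InClosure G xs) (σ-involutive v)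
              (inClosure-mirror closed (x , y , x∈xs , y∈xs , x-σv-y)))

  mirror-position-loses : ∀ k {xs} → N ≤ length xs + k → Unique xs →
                          MirrorClosed xs → ContainsFixedPoints xs → MoverLoses G xs
  mirror-position-loses zero {xs} bound u _ _ = allMoves λ v v∉ →
    contradiction (≤-trans (Unique⇒length≤ ι (¬Any⇒All¬ xs (v∉ ∘ ∈⇒inClosure) ∷ u))
                           (≤-trans bound (≤-reflexive (+-identityʳ (length xs)))))
                  (n≮n (length xs))
  mirror-position-loses (suc k) {xs} bound u closed fixed = allMoves reply
    where
    reply : ∀ v → ¬ InClosure G xs v → MoverWins G (v ∷ xs)
    reply v v∉ = move (σ v) σv∉ (mirror-position-loses k bound′ unique′ closed′ fixed′)
      where
      σv∉ : ¬ InClosure G (v ∷ xs) (σ v)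
      σv∉ = mirror-reply-legal closed fixed v∉
      bound′ : N ≤ length (σ v ∷ v ∷ xs) + k
      bound′ = ≤-trans bound (≤-trans (≤-reflexive (+-suc (length xs) k)) (n≤1+n _))
      unique′ : Unique (σ v ∷ v ∷ xs)
      unique′ = ¬Any⇒All¬ (v ∷ xs) (σv∉ ∘ ∈⇒inClosure) ∷ ¬Any⇒All¬ xs (v∉ ∘ ∈⇒inClosure) ∷ u
      closed′ : MirrorClosed (σ v ∷ v ∷ xs)
      closed′ (here refl)          = there (here (σ-involutive v))
      closed′ (there (here refl))  = here refl
      closed′ (there (there x∈xs)) = there (there (closed x∈xs))
      fixed′ : ContainsFixedPoints (σ v ∷ v ∷ xs)
      fixed′ x σx≡x = there (there (fixed x σx≡x))

  fixed-point-free⇒loses : (∀ x → σ x ≢ x) → MoverLoses G []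
  fixed-point-free⇒loses free =
    mirror-position-loses N ≤-refl [] (λ ()) (λ x σx≡x → contradiction σx≡x (free x))

  centre-first⇒wins : ∀ {c} → σ c ≡ c → (∀ {x} → σ x ≡ x → x ≡ c) → MoverWins G []
  centre-first⇒wins {c} σc≡c unique =
    move c (λ { (_ , _ , () , _) }) (mirror-position-loses N (m≤n+m N 1) (All.[] ∷ []) closed fixed)
    where
    closed : MirrorClosed (c ∷ [])
    closed (here refl) = here σc≡c
    fixed : ContainsFixedPoints (c ∷ [])
    fixed x σx≡x = here (unique σx≡x)

Betweenℕ : ℕ → ℕ → ℕ → Set
Betweenℕ x z y = ∣ x - z ∣ + ∣ z - y ∣ ≡ ∣ x - y ∣

_∈[_,_] : ℕ → ℕ → ℕ → Set
z ∈[ x , y ] = (x ≤ z × z ≤ y) ⊎ (y ≤ z × z ≤ x)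

betweenℕ-sym : ∀ {x z y} → Betweenℕ x z y → Betweenℕ y z x
betweenℕ-sym {x} {z} {y} x-z-y = begin
  ∣ y - z ∣ + ∣ z - x ∣ ≡⟨ cong₂ _+_ (∣-∣-comm y z) (∣-∣-comm z x) ⟩
  ∣ z - y ∣ + ∣ x - z ∣ ≡⟨ +-comm ∣ z - y ∣ ∣ x - z ∣ ⟩
  ∣ x - z ∣ + ∣ z - y ∣ ≡⟨ x-z-y ⟩
  ∣ x - y ∣             ≡⟨ ∣-∣-comm x y ⟩
  ∣ y - x ∣             ∎
  where open ≡-Reasoning

betweenℕ-antisym : ∀ {x z y} → Betweenℕ x z y → Betweenℕ x y z → z ≡ y
betweenℕ-antisym {x} {z} {y} x-z-y x-y-z =
  ∣m-n∣≡0⇒m≡n (m+n≡0⇒m≡0 ∣ z - y ∣ (+-cancelˡ-≡ ∣ x - z ∣ _ 0 (begin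
    ∣ x - z ∣ + (∣ z - y ∣ + ∣ y - z ∣) ≡⟨ +-assoc ∣ x - z ∣ ∣ z - y ∣ ∣ y - z ∣ ⟨
    ∣ x - z ∣ + ∣ z - y ∣ + ∣ y - z ∣   ≡⟨ cong (_+ ∣ y - z ∣) x-z-y ⟩
    ∣ x - y ∣ + ∣ y - z ∣               ≡⟨ x-y-z ⟩
    ∣ x - z ∣                           ≡⟨ +-identityʳ ∣ x - z ∣ ⟨
    ∣ x - z ∣ + 0                       ∎)))
  where open ≡-Reasoning

∈[]⇒betweenℕ : ∀ {x z y} → z ∈[ x , y ] → Betweenℕ x z y
∈[]⇒betweenℕ (inj₁ (x≤z , z≤y)) = ascending x≤z z≤y
  where
  ascending : ∀ {x z y} → x ≤ z → z ≤ y → Betweenℕ x z y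
  ascending {x} x≤z z≤y with m≤n⇒∃[o]m+o≡n x≤z | m≤n⇒∃[o]m+o≡n z≤y
  ... | a , refl | b , refl = begin
    ∣ x - x + a ∣ + ∣ x + a - x + a + b ∣ ≡⟨ cong₂ _+_ (∣m-m+n∣≡n x a) (∣m-m+n∣≡n (x + a) b) ⟩
    a + b                                 ≡⟨ ∣m-m+n∣≡n x (a + b) ⟨
    ∣ x - x + (a + b) ∣                   ≡⟨ cong (∣ x -_∣) (+-assoc x a b) ⟨
    ∣ x - x + a + b ∣                     ∎
    where open ≡-Reasoning
∈[]⇒betweenℕ {x} {z} {y} (inj₂ (y≤z , z≤x)) =
  betweenℕ-sym {y} {z} {x} (∈[]⇒betweenℕ (inj₁ (y≤z , z≤x)))

betweenℕ-ordered : ∀ {x z y} → x ≤ y → Betweenℕ x z y → x ≤ z × z ≤ y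
betweenℕ-ordered {x} {z} {y} x≤y x-z-y = x≤z , z≤y
  where
  x≤z : x ≤ z
  x≤z with ≤-total x z
  ... | inj₁ x≤z = x≤z
  ... | inj₂ z≤x = ≤-reflexive (sym (betweenℕ-antisym {y} (betweenℕ-sym {x} x-z-y)
                                       (∈[]⇒betweenℕ {y} {x} {z} (inj₂ (z≤x , x≤y)))))
  z≤y : z ≤ y
  z≤y with ≤-total z y
  ... | inj₁ z≤y = z≤y
  ... | inj₂ y≤z = ≤-reflexive (betweenℕ-antisym {x} x-z-y
                                  (∈[]⇒betweenℕ {x} {y} {z} (inj₁ (x≤y , y≤z))))

betweenℕ⇒∈[] : ∀ {x z y} → Betweenℕ x z y → z ∈[ x , y ]
betweenℕ⇒∈[] {x} {z} {y} x-z-y with ≤-total x y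
... | inj₁ x≤y = inj₁ (betweenℕ-ordered x≤y x-z-y)
... | inj₂ y≤x = inj₂ (betweenℕ-ordered y≤x (betweenℕ-sym {x} x-z-y))

∣-∣-reflect : ∀ {a b x y} → a + x ≡ b + y → ∣ a - b ∣ ≡ ∣ x - y ∣
∣-∣-reflect {a} {b} {x} {y} a+x≡b+y = begin
  ∣ a - b ∣         ≡⟨ ∣m+n-m+o∣≡∣n-o∣ y a b ⟨
  ∣ y + a - y + b ∣ ≡⟨ cong₂ ∣_-_∣ (+-comm y a) (trans (+-comm y b) (sym a+x≡b+y)) ⟩
  ∣ a + y - a + x ∣ ≡⟨ ∣m+n-m+o∣≡∣n-o∣ a y x ⟩
  ∣ y - x ∣         ≡⟨ ∣-∣-comm y x ⟩
  ∣ x - y ∣         ∎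
  where open ≡-Reasoning

m+n≡o+p∧n≤p⇒o≤m : ∀ {m n o p} → m + n ≡ o + p → n ≤ p → o ≤ m
m+n≡o+p∧n≤p⇒o≤m {m} {n} {o} {p} m+n≡o+p n≤p =
  +-cancelʳ-≤ p o m (≤-trans (≤-reflexive (sym m+n≡o+p)) (+-monoʳ-≤ m n≤p))

∈[]-reflect : ∀ {v v′ s s′} → v′ + v ≡ s′ + s → v′ ∈[ v , s ] → v ∈[ s , s′ ]
∈[]-reflect {v} {v′} {s} {s′} eq (inj₁ (v≤v′ , v′≤s)) =
  inj₂ (m+n≡o+p∧n≤p⇒o≤m (trans (+-comm v v′) eq) v′≤s , ≤-trans v≤v′ v′≤s)
∈[]-reflect {v} {v′} {s} {s′} eq (inj₂ (s≤v′ , v′≤v)) =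
  inj₁ (≤-trans s≤v′ v′≤v , m+n≡o+p∧n≤p⇒o≤m (trans (sym eq) (+-comm v′ v)) s≤v′)

module _ {m : ℕ} where

  ascend : ∀ k (i j : Fin m) → toℕ i + k ≡ toℕ j → Walk (Path m) i j k
  ascend zero i j i+0≡j with refl ← toℕ-injective (trans (sym (+-identityʳ (toℕ i))) i+0≡j) = here
  ascend (suc k) i j i+[1+k]≡j = step (inj₁ (toℕ-fromℕ< i+1<m)) (ascend k (fromℕ< i+1<m) j i′+k≡j)
    where
    i+1+k≡j : suc (toℕ i) + k ≡ toℕ j
    i+1+k≡j = trans (sym (+-suc (toℕ i) k)) i+[1+k]≡j
    i+1<m : suc (toℕ i) < m
    i+1<m = ≤-<-trans (m≤m+n (suc (toℕ i)) k) (≤-<-trans (≤-reflexive i+1+k≡j) (toℕ<n j))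
    i′+k≡j : toℕ (fromℕ< i+1<m) + k ≡ toℕ j
    i′+k≡j = trans (cong (_+ k) (toℕ-fromℕ< i+1<m)) i+1+k≡j

  descend : ∀ k (i j : Fin m) → toℕ j + k ≡ toℕ i → Walk (Path m) i j k
  descend zero i j j+0≡i with refl ← toℕ-injective (trans (sym (+-identityʳ (toℕ j))) j+0≡i) = here
  descend (suc k) i j j+[1+k]≡i =
    step (inj₂ i≡1+i′) (descend k (fromℕ< j+k<m) j (sym (toℕ-fromℕ< j+k<m)))
    where
    j+1+k≡i : suc (toℕ j + k) ≡ toℕ i
    j+1+k≡i = trans (sym (+-suc (toℕ j) k)) j+[1+k]≡i
    j+k<m : toℕ j + k < m
    j+k<m = ≤-<-trans (≤-trans (n≤1+n _) (≤-reflexive j+1+k≡i)) (toℕ<n i)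
    i≡1+i′ : toℕ i ≡ suc (toℕ (fromℕ< j+k<m))
    i≡1+i′ = trans (sym j+1+k≡i) (cong suc (sym (toℕ-fromℕ< j+k<m)))

  adjacent⇒∣-∣≡1 : ∀ {i j} → Adj (Path m) i j → ∣ toℕ i - toℕ j ∣ ≡ 1
  adjacent⇒∣-∣≡1 {i} {j} (inj₁ j≡1+i) =
    trans (cong (∣ toℕ i -_∣) j≡1+i) (trans (m≤n⇒∣m-n∣≡n∸m (n≤1+n (toℕ i))) (m+n∸n≡m 1 (toℕ i)))
  adjacent⇒∣-∣≡1 {i} {j} (inj₂ i≡1+j) =
    trans (∣-∣-comm (toℕ i) (toℕ j)) (adjacent⇒∣-∣≡1 (inj₁ i≡1+j))

pathDistance : ∀ m → Distance (Path m)
pathDistance m = record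
  { d        = λ i j → ∣ toℕ i - toℕ j ∣
  ; geodesic = geodesic
  ; d≤length = d≤length
  ; d-sym    = λ i j → ∣-∣-comm (toℕ i) (toℕ j)
  }
  where
  geodesic : ∀ i j → Walk (Path m) i j ∣ toℕ i - toℕ j ∣
  geodesic i j with ≤-total (toℕ i) (toℕ j)
  ... | inj₁ i≤j = ascend _ i j (trans (cong (toℕ i +_) (m≤n⇒∣m-n∣≡n∸m i≤j)) (m+[n∸m]≡n i≤j))
  ... | inj₂ j≤i = descend _ i j (trans (cong (toℕ j +_) (m≤n⇒∣n-m∣≡n∸m j≤i)) (m+[n∸m]≡n j≤i))

  d≤length : ∀ {i j l} → Walk (Path m) i j l → ∣ toℕ i - toℕ j ∣ ≤ l
  d≤length {i} here = ≤-reflexive (∣n-n∣≡0 (toℕ i))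
  d≤length {i} {j} (step {y = k} e w) = begin
    ∣ toℕ i - toℕ j ∣                     ≤⟨ ∣-∣-triangle (toℕ i) (toℕ k) (toℕ j) ⟩
    ∣ toℕ i - toℕ k ∣ + ∣ toℕ k - toℕ j ∣ ≡⟨ cong (_+ ∣ toℕ k - toℕ j ∣) (adjacent⇒∣-∣≡1 e) ⟩
    suc ∣ toℕ k - toℕ j ∣                 ≤⟨ s≤s (d≤length w) ⟩
    suc _                                 ∎
    where open ≤-Reasoning

1+n*2≡n+[1+n] : ∀ n → 1 + n * 2 ≡ n + suc n
1+n*2≡n+[1+n] n = begin
  1 + n * 2         ≡⟨ cong suc (*-comm n 2) ⟩
  suc (n + (n + 0)) ≡⟨ cong (suc ∘ (n +_)) (+-identityʳ n) ⟩
  suc (n + n)       ≡⟨ +-suc n n ⟨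
  n + suc n         ∎
  where open ≡-Reasoning

Odd⇒1+[m/2]*2≡m : ∀ {m} → Odd m → 1 + m / 2 * 2 ≡ m
Odd⇒1+[m/2]*2≡m {m} m%2≡1 = trans (cong (_+ m / 2 * 2) (sym m%2≡1)) (sym (m≡m%n+[m/n]*n m 2))

1+n*2-Odd : ∀ n → Odd (1 + n * 2)
1+n*2-Odd n = [m+kn]%n≡m%n 1 n 2

module _ {m : ℕ} where

  opposite+1+i≡m : ∀ (i : Fin m) → toℕ (opposite i) + suc (toℕ i) ≡ m
  opposite+1+i≡m i = trans (cong (_+ suc (toℕ i)) (opposite-prop i)) (m∸n+n≡m (toℕ<n i))

  opposite-balanced : ∀ (i j : Fin m) → toℕ (opposite i) + toℕ i ≡ toℕ (opposite j) + toℕ j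
  opposite-balanced i j = suc-injective (begin
    suc (toℕ (opposite i) + toℕ i) ≡⟨ +-suc (toℕ (opposite i)) (toℕ i) ⟨
    toℕ (opposite i) + suc (toℕ i) ≡⟨ trans (opposite+1+i≡m i) (sym (opposite+1+i≡m j)) ⟩
    toℕ (opposite j) + suc (toℕ j) ≡⟨ +-suc (toℕ (opposite j)) (toℕ j) ⟩
    suc (toℕ (opposite j) + toℕ j) ∎)
    where open ≡-Reasoning

  opposite-isometry : ∀ (i j : Fin m) → ∣ toℕ (opposite i) - toℕ (opposite j) ∣ ≡ ∣ toℕ i - toℕ j ∣
  opposite-isometry i j = ∣-∣-reflect {toℕ (opposite i)} {toℕ (opposite j)} (opposite-balanced i j)

  opposite-beyond : ∀ {v s : Fin m} → Betweenℕ (toℕ v) (toℕ (opposite v)) (toℕ s) →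
                    Betweenℕ (toℕ s) (toℕ v) (toℕ (opposite s))
  opposite-beyond {v} {s} v-σv-s = ∈[]⇒betweenℕ {toℕ s} {toℕ v} {toℕ (opposite s)}
    (∈[]-reflect (opposite-balanced v s) (betweenℕ⇒∈[] {toℕ v} {toℕ (opposite v)} {toℕ s} v-σv-s))

  opposite-fixed⇒ : ∀ {i : Fin m} → opposite i ≡ i → 1 + toℕ i * 2 ≡ m
  opposite-fixed⇒ {i} σi≡i = begin
    1 + toℕ i * 2                  ≡⟨ 1+n*2≡n+[1+n] (toℕ i) ⟩
    toℕ i + suc (toℕ i)            ≡⟨ cong (λ k → toℕ k + suc (toℕ i)) σi≡i ⟨
    toℕ (opposite i) + suc (toℕ i) ≡⟨ opposite+1+i≡m i ⟩
    m                              ∎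
    where open ≡-Reasoning

  opposite-fixed⇐ : ∀ {i : Fin m} → 1 + toℕ i * 2 ≡ m → opposite i ≡ i
  opposite-fixed⇐ {i} 1+i*2≡m = toℕ-injective (+-cancelʳ-≡ (suc (toℕ i)) _ _ (begin
    toℕ (opposite i) + suc (toℕ i) ≡⟨ opposite+1+i≡m i ⟩
    m                              ≡⟨ 1+i*2≡m ⟨
    1 + toℕ i * 2                  ≡⟨ 1+n*2≡n+[1+n] (toℕ i) ⟩
    toℕ i + suc (toℕ i)            ∎))
    where open ≡-Reasoning

  opposite-fixed⇒Odd : ∀ {i : Fin m} → opposite i ≡ i → Odd m
  opposite-fixed⇒Odd {i} σi≡i = subst Odd (opposite-fixed⇒ σi≡i) (1+n*2-Odd (toℕ i))

  opposite-fixed-unique : ∀ {i j : Fin m} → opposite i ≡ i → opposite j ≡ j → i ≡ j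
  opposite-fixed-unique {i} {j} σi≡i σj≡j = toℕ-injective
    (*-cancelʳ-≡ (toℕ i) (toℕ j) 2
      (suc-injective (trans (opposite-fixed⇒ σi≡i) (sym (opposite-fixed⇒ σj≡j)))))

  Odd⇒opposite-fixed : Odd m → ∃ λ (c : Fin m) → opposite c ≡ c
  Odd⇒opposite-fixed odd =
    c , opposite-fixed⇐ (trans (cong (λ k → 1 + k * 2) (toℕ-fromℕ< m/2<m)) 1+[m/2]*2≡m)
    where
    1+[m/2]*2≡m : 1 + m / 2 * 2 ≡ m
    1+[m/2]*2≡m = Odd⇒1+[m/2]*2≡m odd
    m/2<m : m / 2 < m
    m/2<m = ≤-trans (s≤s (m≤m*n (m / 2) 2)) (≤-reflexive 1+[m/2]*2≡m)
    c : Fin m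
    c = fromℕ< m/2<m

pathMirror : ∀ m → Mirror (pathDistance m)
pathMirror m = record
  { σ            = opposite
  ; σ-involutive = opposite-involutive
  ; σ-isometry   = opposite-isometry
  ; σ-beyond     = λ {v} {s} → opposite-beyond {v = v} {s}
  }

gridDistance : ∀ {j} (n : Vec ℕ (suc j)) → Distance (Grid n)
gridDistance {zero}  (m ∷ []) = pathDistance m
gridDistance {suc j} (m ∷ ms) = pathDistance m ×ᴰ gridDistance ms

gridMirror : ∀ {j} (n : Vec ℕ (suc j)) → Mirror (gridDistance n)
gridMirror {zero}  (m ∷ []) = pathMirror m
gridMirror {suc j} (m ∷ ms) = pathMirror m ×ᴹ gridMirror ms

gridEncoding : ∀ {j} (n : Vec ℕ (suc j)) → ∃ λ N → V (Grid n) ↣ Fin N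
gridEncoding {zero}  (m ∷ []) = m , ↣-id _
gridEncoding {suc j} (m ∷ ms) with gridEncoding ms
... | N , ι = m * N , ↔⇒↣ (↔-sym *↔×) ↣-∘ (↣-id _ ×-↣ ι)

grid-fixed⇒All-Odd : ∀ {j} (n : Vec ℕ (suc j)) {x} → Mirror.σ (gridMirror n) x ≡ x → All Odd n
grid-fixed⇒All-Odd {zero}  (m ∷ [])  σx≡x = opposite-fixed⇒Odd σx≡x ∷ []
grid-fixed⇒All-Odd {suc j} (m ∷ ms) σx≡x =
  opposite-fixed⇒Odd (cong proj₁ σx≡x) ∷ grid-fixed⇒All-Odd ms (cong proj₂ σx≡x)

grid-fixed-unique : ∀ {j} (n : Vec ℕ (suc j)) {x y} →
                    Mirror.σ (gridMirror n) x ≡ x → Mirror.σ (gridMirror n) y ≡ y → x ≡ y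
grid-fixed-unique {zero}  (m ∷ [])  σx≡x σy≡y = opposite-fixed-unique σx≡x σy≡y
grid-fixed-unique {suc j} (m ∷ ms) σx≡x σy≡y =
  cong₂ _,_ (opposite-fixed-unique (cong proj₁ σx≡x) (cong proj₁ σy≡y))
            (grid-fixed-unique ms (cong proj₂ σx≡x) (cong proj₂ σy≡y))

All-Odd⇒grid-fixed : ∀ {j} (n : Vec ℕ (suc j)) → All Odd n → ∃ λ c → Mirror.σ (gridMirror n) c ≡ c
All-Odd⇒grid-fixed {zero}  (m ∷ [])  (odd ∷ [])  = Odd⇒opposite-fixed odd
All-Odd⇒grid-fixed {suc j} (m ∷ ms) (odd ∷ odds)
  with Odd⇒opposite-fixed odd | All-Odd⇒grid-fixed ms odds
... | c₁ , σc₁≡c₁ | c₂ , σc₂≡c₂ = (c₁ , c₂) , cong₂ _,_ σc₁≡c₁ σc₂≡c₂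

theorem3 : (j : ℕ) → (n : Vec ℕ (suc j)) → All (λ m → 1 ≤ m) n →
    (OutcomeN (Grid n) ⇔ All Odd n)
theorem3 j n _ = mk⇔ first-wins⇒All-Odd All-Odd⇒first-wins
  where
  open MirrorStrategy (gridMirror n) (proj₂ (gridEncoding n))

  All-Odd⇒first-wins : All Odd n → OutcomeN (Grid n)
  All-Odd⇒first-wins odd with All-Odd⇒grid-fixed n odd
  ... | c , σc≡c = centre-first⇒wins σc≡c (λ σx≡x → grid-fixed-unique n σx≡x σc≡c)

  first-wins⇒All-Odd : OutcomeN (Grid n) → All Odd n
  first-wins⇒All-Odd wins = decidable-stable (all? (λ m → m % 2 ≟ 1) n) λ ¬odd →
    wins⇒¬loses wins (fixed-point-free⇒loses λ x σx≡x → ¬odd (grid-fixed⇒All-Odd n σx≡x))
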